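{- For every positive integer $k$ there are $\mathrm{MSO}_2$ sentences $\varphi_{\textsc{DualMinHLT}}$, $\varphi_{\textsc{MinLLT}}$, $\varphi_{\textsc{MaxLLT}}$, each of length $O(k^2)$, such that for every graph $G$ with $n$ vertices: (1) $G\models\varphi_{\textsc{DualMinHLT}}$ if and only if $G$ has a DFS tree of height at most $n-k$; (2) $G\models\varphi_{\textsc{MinLLT}}$ if and only if $G$ has a DFS tree with at most $k$ leaves; (3) $G\models\varphi_{\textsc{MaxLLT}}$ if and only if $G$ has a DFS tree with at least $k$ leaves.
   Context: $\mathrm{MSO}_2$ is monadic second-order logic on graphs allowing quantification over vertices, edges, vertex sets and edge sets, with the vertex–edge incidence relation. All graphs are simple, finite, undirected and connected. A DFS tree of a connected graph $G$ is a spanning tree of $G$ with a root such that for every edge $uv\in E(G)$, $u$ and $v$ are in an ancestor–descendant relationship; the height of a rooted tree is the number of vertices on a longest root-to-leaf path. -}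

module Defs where

open import Data.Nat using (ℕ; zero; suc; _+_; _*_; _∸_; _≤_; _<_)
open import Data.Fin using (Fin; zero; suc; _≟_)
open import Data.Bool using (Bool; true; false; _∧_; _∨_; not; if_then_else_)
open import Data.List using (List; []; _∷_; concatMap; filter; length; allFin)
open import Data.Bool.ListAction using (any)
open import Data.Product using (Σ; _×_; _,_; proj₁; proj₂; ∃)
open import Data.Sum using (_⊎_)
open import Relation.Binary.PropositionalEquality using (_≡_; _≢_)
open import Relation.Nullary.Decidable using (⌊_⌋)

record Graph : Set where
  field
    n    : ℕ
    m    : ℕ
    ends : Fin m → Fin n × Fin n
    loopless : ∀ e → proj₁ (ends e) ≢ proj₂ (ends e)
    noParallel : ∀ e f →
      (proj₁ (ends e) ≡ proj₁ (ends f) × proj₂ (ends e) ≡ proj₂ (ends f)) ⊎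
      (proj₁ (ends e) ≡ proj₂ (ends f) × proj₂ (ends e) ≡ proj₁ (ends f)) →
      e ≡ f
open Graph public

incident : (G : Graph) → Fin (n G) → Fin (m G) → Bool
incident G v e = ⌊ v ≟ proj₁ (ends G e) ⌋ ∨ ⌊ v ≟ proj₂ (ends G e) ⌋

Adj : (G : Graph) → Fin (n G) → Fin (n G) → Set
Adj G u v = Σ (Fin (m G)) λ e →
  (proj₁ (ends G e) ≡ u × proj₂ (ends G e) ≡ v) ⊎
  (proj₁ (ends G e) ≡ v × proj₂ (ends G e) ≡ u)

data Reach (G : Graph) : Fin (n G) → Fin (n G) → Set where
  here : ∀ {u} → Reach G u u
  step : ∀ {u v w} → Adj G u v → Reach G v w → Reach G u w

Connected : Graph → Set
Connected G = (0 < n G) × (∀ u v → Reach G u v)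

-- MSO₂ formulas, well-scoped (de Bruijn) with four sorts of variables:
-- a vertex variables, b edge variables, c vertex-set variables,
-- d edge-set variables.

data Form : ℕ → ℕ → ℕ → ℕ → Set where
  eqV  : ∀ {a b c d} → Fin a → Fin a → Form a b c d
  eqE  : ∀ {a b c d} → Fin b → Fin b → Form a b c d
  inc  : ∀ {a b c d} → Fin a → Fin b → Form a b c d
  memV : ∀ {a b c d} → Fin a → Fin c → Form a b c d
  memE : ∀ {a b c d} → Fin b → Fin d → Form a b c d
  ¬'   : ∀ {a b c d} → Form a b c d → Form a b c d
  _∧'_ : ∀ {a b c d} → Form a b c d → Form a b c d → Form a b c d
  _∨'_ : ∀ {a b c d} → Form a b c d → Form a b c d → Form a b c d
  ∃v   : ∀ {a b c d} → Form (suc a) b c d → Form a b c d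
  ∃e   : ∀ {a b c d} → Form a (suc b) c d → Form a b c d
  ∃V   : ∀ {a b c d} → Form a b (suc c) d → Form a b c d
  ∃E   : ∀ {a b c d} → Form a b c (suc d) → Form a b c d
  ∀v   : ∀ {a b c d} → Form (suc a) b c d → Form a b c d
  ∀e   : ∀ {a b c d} → Form a (suc b) c d → Form a b c d
  ∀V   : ∀ {a b c d} → Form a b (suc c) d → Form a b c d
  ∀E   : ∀ {a b c d} → Form a b c (suc d) → Form a b c d

Sentence : Set
Sentence = Form 0 0 0 0

size : ∀ {a b c d} → Form a b c d → ℕ
size (eqV _ _)  = 1
size (eqE _ _)  = 1
size (inc _ _)  = 1
size (memV _ _) = 1
size (memE _ _) = 1
size (¬' φ)     = suc (size φ)
size (φ ∧' ψ)   = suc (size φ + size ψ)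
size (φ ∨' ψ)   = suc (size φ + size ψ)
size (∃v φ) = suc (size φ)
size (∃e φ) = suc (size φ)
size (∃V φ) = suc (size φ)
size (∃E φ) = suc (size φ)
size (∀v φ) = suc (size φ)
size (∀e φ) = suc (size φ)
size (∀V φ) = suc (size φ)
size (∀E φ) = suc (size φ)

subsets : (k : ℕ) → List (Fin k → Bool)
subsets zero = (λ ()) ∷ []
subsets (suc k) = concatMap
  (λ S → (λ { zero → true ; (suc i) → S i }) ∷ (λ { zero → false ; (suc i) → S i }) ∷ [])
  (subsets k)

ext : ∀ {a} {X : Set} → (Fin a → X) → X → Fin (suc a) → X
ext ρ x zero = x
ext ρ x (suc i) = ρ i

all' : ∀ {X : Set} → (X → Bool) → List X → Bool
all' p xs = not (any (λ x → not (p x)) xs)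

-- Semantics (finite domains, so Bool-valued)
eval : (G : Graph) → ∀ {a b c d} → Form a b c d →
       (Fin a → Fin (n G)) → (Fin b → Fin (m G)) →
       (Fin c → Fin (n G) → Bool) → (Fin d → Fin (m G) → Bool) → Bool
eval G (eqV i j)  ρv ρe ρV ρE = ⌊ ρv i ≟ ρv j ⌋
eval G (eqE i j)  ρv ρe ρV ρE = ⌊ ρe i ≟ ρe j ⌋
eval G (inc i j)  ρv ρe ρV ρE = incident G (ρv i) (ρe j)
eval G (memV i X) ρv ρe ρV ρE = ρV X (ρv i)
eval G (memE i X) ρv ρe ρV ρE = ρE X (ρe i)
eval G (¬' φ)     ρv ρe ρV ρE = not (eval G φ ρv ρe ρV ρE)
eval G (φ ∧' ψ)   ρv ρe ρV ρE = eval G φ ρv ρe ρV ρE ∧ eval G ψ ρv ρe ρV ρE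
eval G (φ ∨' ψ)   ρv ρe ρV ρE = eval G φ ρv ρe ρV ρE ∨ eval G ψ ρv ρe ρV ρE
eval G (∃v φ) ρv ρe ρV ρE = any (λ x → eval G φ (ext ρv x) ρe ρV ρE) (allFin (n G))
eval G (∃e φ) ρv ρe ρV ρE = any (λ x → eval G φ ρv (ext ρe x) ρV ρE) (allFin (m G))
eval G (∃V φ) ρv ρe ρV ρE = any (λ S → eval G φ ρv ρe (ext ρV S) ρE) (subsets (n G))
eval G (∃E φ) ρv ρe ρV ρE = any (λ S → eval G φ ρv ρe ρV (ext ρE S)) (subsets (m G))
eval G (∀v φ) ρv ρe ρV ρE = all' (λ x → eval G φ (ext ρv x) ρe ρV ρE) (allFin (n G))
eval G (∀e φ) ρv ρe ρV ρE = all' (λ x → eval G φ ρv (ext ρe x) ρV ρE) (allFin (m G))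
eval G (∀V φ) ρv ρe ρV ρE = all' (λ S → eval G φ ρv ρe (ext ρV S) ρE) (subsets (n G))
eval G (∀E φ) ρv ρe ρV ρE = all' (λ S → eval G φ ρv ρe ρV (ext ρE S)) (subsets (m G))

_⊨_ : Graph → Sentence → Set
G ⊨ φ = eval G φ (λ ()) (λ ()) (λ ()) (λ ()) ≡ true

iter : ∀ {X : Set} → (X → X) → ℕ → X → X
iter f zero x = x
iter f (suc k) x = f (iter f k x)

record RootedSpanningTree (G : Graph) : Set where
  field
    root   : Fin (n G)
    parent : Fin (n G) → Fin (n G)
    parent-root : parent root ≡ root
    parent-edge : ∀ v → v ≢ root → Adj G v (parent v)
    reaches-root : ∀ v → ∃ λ k → iter parent k v ≡ root
open RootedSpanningTree public

-- u is an ancestor of v (every vertex is an ancestor of itself)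
Ancestor : ∀ {G} → RootedSpanningTree G → Fin (n G) → Fin (n G) → Set
Ancestor T u v = ∃ λ k → iter (parent T) k v ≡ u

IsDFSTree : ∀ {G} → RootedSpanningTree G → Set
IsDFSTree {G} T = ∀ e →
  Ancestor T (proj₁ (ends G e)) (proj₂ (ends G e)) ⊎
  Ancestor T (proj₂ (ends G e)) (proj₁ (ends G e))

-- height ≤ h: every root-to-vertex path has at most h vertices,
-- i.e. every vertex has depth < h
HeightAtMost : ∀ {G} → RootedSpanningTree G → ℕ → Set
HeightAtMost T h = ∀ v → ∃ λ k → suc k ≤ h × iter (parent T) k v ≡ root T

isLeaf : ∀ {G} → RootedSpanningTree G → Fin (n G) → Bool
isLeaf {G} T v =
  not (any (λ u → not ⌊ u ≟ v ⌋ ∧ ⌊ parent T u ≟ v ⌋) (allFin (n G)))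

numLeaves : ∀ {G} → RootedSpanningTree G → ℕ
numLeaves {G} T = length (filter (λ v → isLeaf T v ≡? true) (allFin (n G)))
  where
  open import Data.Bool.Properties using () renaming (_≟_ to _≡?_)

-- A DFS tree is guessed by its root r, its set F of tree edges and the layers L₀, L₁, L₂
-- of vertices whose depth is 0, 1, 2 mod 3. The layers orient every tree edge,
-- so "u is the parent of v" becomes a formula of constant size; ancestry is membership in
-- every parent-closed vertex set containing the descendant, and the DFS condition asks the
-- ends of every edge to be comparable. "At least k leaves" guesses k pairwise distinct
-- leaves (the O(k²) distinctness constraints dominate the size), "at most k leaves" negates
-- "at least k+1", and "height ≤ n − k" says that every vertex has k non-ancestors, since the
-- ancestors of v are exactly the depth(v) + 1 vertices of its root path. Conversely, a
-- labelling satisfying these constraints defines a parent function, well founded because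
-- no nonempty vertex set contains the parents of all its members, whose tree is a DFS tree.

module Submission where

open import Defs
open import Data.Nat using (ℕ; _*_; _∸_; _≤_; _<_)
open import Data.Product using (Σ; _×_; ∃)
open import Function.Bundles using (_⇔_)

open import Data.Bool using (Bool; true; false; T; not; _∧_)
open import Data.Bool.ListAction using (any)
open import Data.Bool.Properties using (T?; T-≡; T-∧; T-∨) renaming (_≟_ to _≟ᵇ_)
open import Data.Empty using (⊥-elim)
open import Data.Fin using (Fin; zero; suc; toℕ; fromℕ<; _≟_)
import Data.Fin.Properties as Fin
open import Data.List using (List; []; _∷_; allFin; filter; length; lookup)
import Data.List.Properties as List
open import Data.List.Membership.Propositional using (_∈_; find; lose)
open import Data.List.Membership.Propositional.Properties using (∈-allFin; ∈-concatMap⁺; ∈-filter⁺; ∈-lookup)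
open import Data.List.Membership.Setoid.Properties using (index-injective)
import Data.List.Relation.Unary.All as All
open import Data.List.Relation.Unary.All.Properties using (all-filter)
open import Data.List.Relation.Unary.AllPairs using (_∷_)
open import Data.List.Relation.Unary.Any using (here; there)
import Data.List.Relation.Unary.Any as Any
open import Data.List.Relation.Unary.Any.Properties using (any⁺; any⁻)
open import Data.List.Relation.Unary.Unique.Propositional using (Unique)
import Data.List.Relation.Unary.Unique.Propositional.Properties as Unique
open import Data.Nat using (zero; suc; _+_; s≤s; z≤n)
open import Data.Nat.Induction using (<-rec)
open import Data.Nat.Tactic.RingSolver using (solve)
import Data.Nat.Properties as ℕ
open import Data.Product using (_,_; proj₁; proj₂)
open import Data.Product.Function.NonDependent.Propositional using (_×-cong_)
open import Data.Sum using (_⊎_; inj₁; inj₂)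
import Data.Sum as Sum
open import Data.Sum.Function.Propositional using (_⊎-cong_)
open import Function using (_∘_; id)
open import Function.Bundles using (mk⇔; Equivalence)
open import Function.Construct.Composition using (_⇔-∘_)
open import Function.Construct.Identity using (⇔-id)
open import Function.Construct.Symmetry using (⇔-sym)
open import Function.Definitions using (Injective)
open import Function.Related.TypeIsomorphisms using (¬-cong-⇔)
open import Relation.Binary.Definitions using (tri<; tri≈; tri>)
open import Relation.Binary.PropositionalEquality
  using (_≡_; _≢_; refl; sym; trans; cong; cong₂; subst; _≗_; setoid; module ≡-Reasoning)
open import Relation.Nullary using (¬_; ¬?; Dec; yes; no; _×-dec_; _⊎-dec_)
open import Relation.Nullary.Decidable using (⌊_⌋; toWitness; fromWitness; toWitnessFalse; fromWitnessFalse)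
open import Relation.Unary using (Decidable)
open import Relation.Unary.Properties using (∁?)

open Equivalence using (to; from)

private variable
  a b c d : ℕ

T-⌊⌋⇔ : ∀ {A : Set} (A? : Dec A) → T ⌊ A? ⌋ ⇔ A
T-⌊⌋⇔ A? = mk⇔ toWitness fromWitness

T-not⌊⌋⇔¬ : ∀ {A : Set} (A? : Dec A) → T (not ⌊ A? ⌋) ⇔ (¬ A)
T-not⌊⌋⇔¬ A? = mk⇔ toWitnessFalse fromWitnessFalse

T-not⇔¬T : ∀ {b} → T (not b) ⇔ (¬ T b)
T-not⇔¬T {false} = mk⇔ (λ _ ()) _
T-not⇔¬T {true}  = mk⇔ (λ ()) (λ ¬⊤ → ¬⊤ _)

Σ-cong-⇔ : ∀ {A : Set} {P Q : A → Set} → (∀ x → P x ⇔ Q x) → Σ A P ⇔ Σ A Q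
Σ-cong-⇔ P⇔Q = mk⇔ (λ (x , p) → x , to (P⇔Q x) p) (λ (x , q) → x , from (P⇔Q x) q)

≡⇒⇔ : ∀ {A B : Set} → A ≡ B → A ⇔ B
≡⇒⇔ refl = mk⇔ id id

Π-cong-⇔ : ∀ {A : Set} {P Q : A → Set} → (∀ x → P x ⇔ Q x) → (∀ x → P x) ⇔ (∀ x → Q x)
Π-cong-⇔ P⇔Q = mk⇔ (λ p x → to (P⇔Q x) (p x)) (λ q x → from (P⇔Q x) (q x))

¬⊎⇒→ : ∀ {A B : Set} → ¬ A ⊎ B → A → B
¬⊎⇒→ (inj₁ ¬a) a = ⊥-elim (¬a a)
¬⊎⇒→ (inj₂ b)  _ = b

→⇒¬⊎-by-premise : ∀ {A B : Set} → Dec A → (A → B) → ¬ A ⊎ B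
→⇒¬⊎-by-premise (yes a) f = inj₂ (f a)
→⇒¬⊎-by-premise (no ¬a) _ = inj₁ ¬a

→⇒¬⊎-by-conclusion : ∀ {A B : Set} → Dec B → (A → B) → ¬ A ⊎ B
→⇒¬⊎-by-conclusion (yes b) _ = inj₂ b
→⇒¬⊎-by-conclusion (no ¬b) f = inj₁ (¬b ∘ f)

-- Quantifiers evaluated over finite enumerations

subsets-complete : ∀ k (S : Fin k → Bool) → ∃ λ S' → S' ∈ subsets k × S' ≗ S
subsets-complete zero    S = _ , here refl , λ ()
subsets-complete (suc k) S with subsets-complete k (S ∘ suc) | S zero in S₀
... | S' , S'∈ , S'≗ | true  = _ , ∈-concatMap⁺ _ (Any.map (λ { refl → here refl }) S'∈) ,
                                λ { zero → sym S₀ ; (suc i) → S'≗ i }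
... | S' , S'∈ , S'≗ | false = _ , ∈-concatMap⁺ _ (Any.map (λ { refl → there (here refl) }) S'∈) ,
                                λ { zero → sym S₀ ; (suc i) → S'≗ i }

module Quantifiers {X : Set} (_≈_ : X → X → Set) (≈-refl : ∀ {x} → x ≈ x)
                   {xs : List X} (covers : ∀ x → ∃ λ x' → x' ∈ xs × x' ≈ x)
                   {p : X → Bool} {Q : X → Set} (p⇔Q : ∀ {x' x} → x' ≈ x → T (p x') ⇔ Q x) where

  T-any⇔∃ : T (any p xs) ⇔ ∃ Q
  T-any⇔∃ = mk⇔ (λ h → let x , _ , px = find (any⁻ p xs h) in x , to (p⇔Q ≈-refl) px)
                (λ (x , q) → let x' , x'∈ , x'≈x = covers x in any⁺ p (lose x'∈ (from (p⇔Q x'≈x) q)))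

  T-all'⇔∀ : T (all' p xs) ⇔ (∀ x → Q x)
  T-all'⇔∀ = mk⇔ holds (λ h → from T-not⇔¬T λ t →
                           let x , _ , ¬px = find (any⁻ (not ∘ p) xs t)
                           in to T-not⇔¬T ¬px (from (p⇔Q ≈-refl) (h x)))
    where
    holds : T (all' p xs) → ∀ x → Q x
    holds h x with covers x
    ... | x' , x'∈ , x'≈x with T? (p x')
    ...   | yes px' = to (p⇔Q x'≈x) px'
    ...   | no ¬px' = ⊥-elim (to T-not⇔¬T h (any⁺ (not ∘ p) (lose x'∈ (from T-not⇔¬T ¬px'))))

allFin-covers : ∀ {k} (x : Fin k) → ∃ λ x' → x' ∈ allFin k × x' ≡ x
allFin-covers x = x , ∈-allFin x , refl

module OverFin {k : ℕ} {p : Fin k → Bool} {Q : Fin k → Set} (p⇔Q : ∀ x → T (p x) ⇔ Q x) where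
  private
    p⇔Q-≡ : ∀ {x' x} → x' ≡ x → T (p x') ⇔ Q x
    p⇔Q-≡ refl = p⇔Q _

  open Quantifiers _≡_ refl allFin-covers p⇔Q-≡ public

module OverSubsets {k : ℕ} {p : (Fin k → Bool) → Bool} {Q : (Fin k → Bool) → Set}
                   (p⇔Q : ∀ {S' S} → S' ≗ S → T (p S') ⇔ Q S) =
  Quantifiers _≗_ (λ _ → refl) (subsets-complete k) p⇔Q

-- Counting elements of a decidable subset of Fin N

lookup-injective : ∀ {X : Set} {xs : List X} → Unique xs → ∀ {i j} → lookup xs i ≡ lookup xs j → i ≡ j
lookup-injective {xs = _ ∷ _} _         {zero}  {zero}  _ = refl
lookup-injective {xs = _ ∷ _} (x∉ ∷ _)  {zero}  {suc j} p = ⊥-elim (All.lookup x∉ (∈-lookup j) p)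
lookup-injective {xs = _ ∷ _} (x∉ ∷ _)  {suc i} {zero}  p = ⊥-elim (All.lookup x∉ (∈-lookup i) (sym p))
lookup-injective {xs = _ ∷ _} (_ ∷ uxs) {suc i} {suc j} p = cong suc (lookup-injective uxs p)

module Counting {N : ℕ} {Q : Fin N → Set} (Q? : Decidable Q) where

  count : ℕ
  count = length (filter Q? (allFin N))

  Injection : ℕ → Set
  Injection k = Σ (Fin k → Fin N) λ f → Injective _≡_ _≡_ f × (∀ i → Q (f i))

  injection⇒≤count : ∀ {k} → Injection k → k ≤ count
  injection⇒≤count (f , f-inj , Qf) = Fin.injective⇒≤ (f-inj ∘ index-injective (setoid _) (member _) (member _))
    where
    member : ∀ i → f i ∈ filter Q? (allFin N)
    member i = ∈-filter⁺ Q? (∈-allFin (f i)) (Qf i)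

  ≤count⇒injection : ∀ {k} → k ≤ count → Injection k
  ≤count⇒injection {k} k≤count = f , f-inj , λ i → All.lookup (all-filter Q? (allFin N)) (∈-lookup (position i))
    where
    position : Fin k → Fin count
    position i = fromℕ< (ℕ.<-≤-trans (Fin.toℕ<n i) k≤count)
    f : Fin k → Fin N
    f = lookup (filter Q? (allFin N)) ∘ position
    f-inj : Injective _≡_ _≡_ f
    f-inj p = Fin.toℕ-injective (Fin.fromℕ<-injective _ _ _ _
                (lookup-injective (Unique.filter⁺ Q? (Unique.allFin⁺ N)) p))

  ≤count⇔injection : ∀ {k} → k ≤ count ⇔ Injection k
  ≤count⇔injection = mk⇔ ≤count⇒injection injection⇒≤count

  count+count∁≡N : count + length (filter (∁? Q?) (allFin N)) ≡ N
  count+count∁≡N = trans (split (allFin N)) (List.length-tabulate id)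
    where
    split : ∀ xs → length (filter Q? xs) + length (filter (∁? Q?) xs) ≡ length xs
    split []       = refl
    split (x ∷ xs) with Q? x
    ... | yes _ = cong suc (split xs)
    ... | no  _ = trans (ℕ.+-suc _ _) (cong suc (split xs))

-- Iterating a function

module _ {X : Set} (f : X → X) where

  iter-suc : ∀ k x → iter f (suc k) x ≡ iter f k (f x)
  iter-suc zero    x = refl
  iter-suc (suc k) x = cong f (iter-suc k x)

  iter-+ : ∀ i j x → iter f (i + j) x ≡ iter f i (iter f j x)
  iter-+ zero    j x = refl
  iter-+ (suc i) j x = cong f (iter-+ i j x)

  iter-fixed : ∀ {x} → f x ≡ x → ∀ k → iter f k x ≡ x
  iter-fixed fx≡x zero    = refl
  iter-fixed fx≡x (suc k) = trans (cong f (iter-fixed fx≡x k)) fx≡x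

  iter-shortcut : ∀ {i j K} x → iter f i x ≡ iter f j x → j ≤ K → iter f (K ∸ j + i) x ≡ iter f K x
  iter-shortcut {i} {j} {K} x same j≤K = begin
    iter f (K ∸ j + i) x        ≡⟨ iter-+ (K ∸ j) i x ⟩
    iter f (K ∸ j) (iter f i x) ≡⟨ cong (iter f (K ∸ j)) same ⟩
    iter f (K ∸ j) (iter f j x) ≡⟨ iter-+ (K ∸ j) j x ⟨
    iter f (K ∸ j + j) x        ≡⟨ cong (λ k → iter f k x) (ℕ.m∸n+n≡m j≤K) ⟩
    iter f K x                  ∎
    where open ≡-Reasoning

shortcut-shorter : ∀ {i j K} → i < j → j ≤ K → K ∸ j + i < K
shortcut-shorter {i} {j} {K} i<j j≤K = subst (K ∸ j + i <_) (ℕ.m∸n+n≡m j≤K) (ℕ.+-monoʳ-< (K ∸ j) i<j)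

module _ {N : ℕ} (f : Fin N → Fin N) where

  reaches-within : ∀ K x y → iter f K x ≡ y → ∃ λ k → k < N × iter f k x ≡ y
  reaches-within = <-rec _ go
    where
    go : ∀ K → (∀ {K'} → K' < K → ∀ x y → iter f K' x ≡ y → ∃ λ k → k < N × iter f k x ≡ y) →
         ∀ x y → iter f K x ≡ y → ∃ λ k → k < N × iter f k x ≡ y
    go K rec x y fᴷx≡y with K ℕ.<? N
    ... | yes K<N = K , K<N , fᴷx≡y
    ... | no K≮N with Fin.pigeonhole (ℕ.n<1+n N) (λ (i : Fin (suc N)) → iter f (toℕ i) x)
    ...   | i , j , i<j , same = rec (shortcut-shorter i<j j≤K) x y (trans (iter-shortcut f x same j≤K) fᴷx≡y)
      where
      j≤K : toℕ j ≤ K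
      j≤K = ℕ.≤-trans (ℕ.≤-pred (Fin.toℕ<n j)) (ℕ.≮⇒≥ K≮N)

  reaches? : ∀ x y → Dec (∃ λ k → iter f k x ≡ y)
  reaches? x y with Fin.any? (λ (i : Fin N) → iter f (toℕ i) x ≟ y)
  ... | yes (i , p) = yes (toℕ i , p)
  ... | no ¬p = no λ (K , fᴷx≡y) → let k , k<N , fᵏx≡y = reaches-within K x y fᴷx≡y in
                  ¬p (fromℕ< k<N , subst (λ k → iter f k x ≡ y) (sym (Fin.toℕ-fromℕ< k<N)) fᵏx≡y)

least-witness : ∀ {Q : ℕ → Set} → Decidable Q → ∀ {K} → Q K → ∃ λ d → Q d × (∀ {j} → Q j → d ≤ j)
least-witness {Q} Q? {K} = <-rec (λ K → Q K → ∃ λ d → Q d × (∀ {j} → Q j → d ≤ j)) go K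
  where
  go : ∀ K → (∀ {K'} → K' < K → Q K' → ∃ λ d → Q d × (∀ {j} → Q j → d ≤ j)) →
       Q K → ∃ λ d → Q d × (∀ {j} → Q j → d ≤ j)
  go K rec QK with ℕ.anyUpTo? Q? K
  ... | yes (j , j<K , Qj) = rec j<K Qj
  ... | no  ¬smaller      = K , QK , λ {j} Qj → ℕ.≮⇒≥ λ j<K → ¬smaller (j , j<K , Qj)

m≤o∸n⇔m+n≤o : ∀ {m n o} → 0 < m → m ≤ o ∸ n ⇔ m + n ≤ o
m≤o∸n⇔m+n≤o {m} {n} {o} 0<m = mk⇔
  (λ m≤o∸n → ℕ.m≤o∸n⇒m+n≤o m (n≤o m≤o∸n) m≤o∸n)
  (ℕ.m+n≤o⇒m≤o∸n m)
  where
  n≤o : m ≤ o ∸ n → n ≤ o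
  n≤o m≤o∸n = ℕ.<⇒≤ (ℕ.m∸n≢0⇒n<m λ o∸n≡0 → ℕ.<⇒≱ 0<m (subst (m ≤_) o∸n≡0 m≤o∸n))

-- The formulas

infixr 4 _⇒'_
_⇒'_ : Form a b c d → Form a b c d → Form a b c d
φ ⇒' ψ = ¬' φ ∨' ψ

record Vars (a c d : ℕ) : Set where
  constructor vars
  field
    rootVar : Fin a
    edgesVar : Fin d
    layerVar₀ layerVar₁ layerVar₂ : Fin c
open Vars

underV : Vars a c d → Vars (suc a) c d
underV x = vars (suc (rootVar x)) (edgesVar x) (layerVar₀ x) (layerVar₁ x) (layerVar₂ x)

underVSet : Vars a c d → Vars a (suc c) d
underVSet x = vars (rootVar x) (edgesVar x) (suc (layerVar₀ x)) (suc (layerVar₁ x)) (suc (layerVar₂ x))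

new : ∀ {k} → Fin k → Fin (k + a)
new zero    = zero
new (suc i) = suc (new i)

old : ∀ k → Fin a → Fin (k + a)
old zero    j = j
old (suc k) j = suc (old k j)

underVs : ∀ k → Vars a c d → Vars (k + a) c d
underVs k x = vars (old k (rootVar x)) (edgesVar x) (layerVar₀ x) (layerVar₁ x) (layerVar₂ x)

NextLayerF : Fin a → Fin a → Vars a c d → Form a b c d
NextLayerF v u x = (memV v (layerVar₀ x) ∧' memV u (layerVar₂ x))
                ∨' ((memV v (layerVar₁ x) ∧' memV u (layerVar₀ x))
                ∨' (memV v (layerVar₂ x) ∧' memV u (layerVar₁ x)))

UpF : Fin a → Fin a → Vars a c d → Form a b c d
UpF v u x = ¬' (eqV v (rootVar x))
         ∧' (∃e (memE zero (edgesVar x) ∧' (inc v zero ∧' inc u zero))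
         ∧' (¬' (eqV u v) ∧' NextLayerF v u x))

LeafF : Fin a → Vars a c d → Form a b c d
LeafF v x = ¬' (∃v (UpF zero (suc v) (underV x)))

UpClosedF : Fin c → Vars a c d → Form a b c d
UpClosedF X x = ∀v (∀v (memV (suc zero) X ⇒' UpF (suc zero) zero (underVs 2 x) ⇒' memV zero X))

AncestorF : Fin a → Fin a → Vars a c d → Form a b c d
AncestorF v w x = ∀V (memV w zero ⇒' UpClosedF zero (underVSet x) ⇒' memV v zero)

HasParentF : Vars a c d → Form a b c d
HasParentF x = ∀v (eqV zero (suc (rootVar x)) ∨' ∃v (UpF (suc zero) zero (underVs 2 x)))

UniqueParentF : Vars a c d → Form a b c d
UniqueParentF x = ∀v (∀v (∀v ((UpF (suc (suc zero)) (suc zero) (underVs 3 x) ∧' UpF (suc (suc zero)) zero (underVs 3 x))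
                              ⇒' eqV (suc zero) zero)))

WellFoundedF : Vars a c d → Form a b c d
WellFoundedF x = ∀V (¬' (∃v (memV zero zero)
                       ∧' ∀v (memV zero zero ⇒' ∃v (UpF (suc zero) zero (underVs 2 (underVSet x)) ∧' memV zero zero))))

AncestralF : Vars a c d → Form a b c d
AncestralF x = ∀e (∀v (∀v ((inc (suc zero) zero ∧' (inc zero zero ∧' ¬' (eqV (suc zero) zero)))
                           ⇒' (AncestorF (suc zero) zero (underVs 2 x) ∨' AncestorF zero (suc zero) (underVs 2 x)))))

DFSLabellingF : Vars a c d → Form a b c d
DFSLabellingF x = HasParentF x ∧' (UniqueParentF x ∧' (WellFoundedF x ∧' AncestralF x))

⊤' : Form a b c d
⊤' = ∀v (eqV zero zero)

⋀ : (k : ℕ) → (Fin k → Form a b c d) → Form a b c d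
⋀ zero    φ = ⊤'
⋀ (suc k) φ = φ zero ∧' ⋀ k (φ ∘ suc)

∃vs : ∀ k → Form (k + a) b c d → Form a b c d
∃vs zero    φ = φ
∃vs (suc k) φ = ∃vs k (∃v φ)

distinctPair : ∀ {k} (i j : Fin k) → Dec (i ≡ j) → Form (k + a) b c d
distinctPair i j (yes _) = ⊤'
distinctPair i j (no  _) = ¬' (eqV (new i) (new j))

Distinct : ∀ k → Form (k + a) b c d
Distinct k = ⋀ k λ i → ⋀ k λ j → distinctPair i j (i ≟ j)

AtLeastLeavesF : ℕ → Vars a c d → Form a b c d
AtLeastLeavesF k x = ∃vs k (Distinct k ∧' ⋀ k λ i → LeafF (new i) (underVs k x))

AtMostLeavesF : ℕ → Vars a c d → Form a b c d
AtMostLeavesF k x = ¬' (AtLeastLeavesF (suc k) x)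

NonAncestorsF : ℕ → Vars a c d → Form a b c d
NonAncestorsF k x = ∀v (∃vs k (Distinct k ∧' ⋀ k λ i → ¬' (AncestorF (new i) (old k zero) (underVs k (underV x)))))

-- the positions of r, F, L₀, L₁, L₂ under the five binders of SomeDFSTreeF
x₀ : Vars 1 3 1
x₀ = vars zero zero (suc (suc zero)) (suc zero) zero

SomeDFSTreeF : Form 1 0 3 1 → Sentence
SomeDFSTreeF ψ = ∃v (∃E (∃V (∃V (∃V (DFSLabellingF x₀ ∧' ψ)))))

φDualMinHLT φMinLLT φMaxLLT : ℕ → Sentence
φDualMinHLT k = SomeDFSTreeF (NonAncestorsF k x₀)
φMinLLT     k = SomeDFSTreeF (AtMostLeavesF k x₀)
φMaxLLT     k = SomeDFSTreeF (AtLeastLeavesF k x₀)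

prepend : ∀ {k} {X : Set} → (Fin k → X) → (Fin a → X) → Fin (k + a) → X
prepend {k = zero}  f ρ = ρ
prepend {k = suc k} f ρ = ext (prepend (f ∘ suc) ρ) (f zero)

prepend-new : ∀ {k} {X : Set} (f : Fin k → X) (ρ : Fin a → X) i → prepend f ρ (new i) ≡ f i
prepend-new f ρ zero    = refl
prepend-new f ρ (suc i) = prepend-new (f ∘ suc) ρ i

prepend-old : ∀ {k} {X : Set} (f : Fin k → X) (ρ : Fin a → X) j → prepend f ρ (old k j) ≡ ρ j
prepend-old {k = zero}  f ρ j = refl
prepend-old {k = suc k} f ρ j = prepend-old (f ∘ suc) ρ j

size-⋀ : ∀ k (φ : Fin k → Form a b c d) {s} → (∀ i → size (φ i) ≡ s) → size (⋀ k φ) ≡ k * suc s + 2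
size-⋀ zero    φ     _    = refl
size-⋀ (suc k) φ {s} same = cong suc (trans (cong₂ _+_ (same zero) (size-⋀ k (φ ∘ suc) (same ∘ suc)))
                                            (sym (ℕ.+-assoc s (k * suc s) 2)))

size-∃vs : ∀ k (φ : Form (k + a) b c d) → size (∃vs k φ) ≡ k + size φ
size-∃vs zero    φ = refl
size-∃vs (suc k) φ = trans (size-∃vs k (∃v φ)) (ℕ.+-suc k (size φ))

size-Distinct : ∀ k → size (Distinct {a = a} {b} {c} {d} k) ≡ k * suc (k * 3 + 2) + 2
size-Distinct k = size-⋀ k _ λ i → size-⋀ k _ λ j → pair i j (i ≟ j)
  where
  pair : ∀ i j (i≟j : Dec (i ≡ j)) → size (distinctPair {a = a} {b} {c} {d} i j i≟j) ≡ 2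
  pair i j (yes _) = refl
  pair i j (no  _) = refl

size-block : ∀ k (φ : Fin k → Form (k + a) b c d) s → (∀ i → size (φ i) ≡ s) →
             size (∃vs k (Distinct k ∧' ⋀ k φ)) ≡ k + suc (k * suc (k * 3 + 2) + 2 + (k * suc s + 2))
size-block k φ s same =
  trans (size-∃vs k _) (cong (λ t → k + suc t) (cong₂ _+_ (size-Distinct k) (size-⋀ k φ same)))

size-SomeDFSTreeF : ∀ ψ → size (SomeDFSTreeF ψ) ≡ 218 + size ψ
size-SomeDFSTreeF ψ = refl

size-φMaxLLT : ∀ k → size (φMaxLLT k) ≡ 3 * (k * k) + 31 * k + 223
size-φMaxLLT k = begin
  size (φMaxLLT k)
    ≡⟨ size-SomeDFSTreeF (AtLeastLeavesF k x₀) ⟩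
  218 + size (AtLeastLeavesF k x₀)
    ≡⟨ cong (218 +_) (size-block k _ 26 λ _ → refl) ⟩
  218 + (k + suc (k * suc (k * 3 + 2) + 2 + (k * 27 + 2)))
    ≡⟨ solve (k ∷ []) ⟩
  3 * (k * k) + 31 * k + 223
    ∎
  where open ≡-Reasoning

size-φMinLLT : ∀ k → size (φMinLLT k) ≡ 3 * (k * k) + 37 * k + 258
size-φMinLLT k = begin
  size (φMinLLT k)
    ≡⟨ size-SomeDFSTreeF (AtMostLeavesF k x₀) ⟩
  218 + suc (size (AtLeastLeavesF (suc k) x₀))
    ≡⟨ cong (λ t → 218 + suc t) (size-block (suc k) leaf 26 λ _ → refl) ⟩
  218 + suc (suc k + suc (suc k * suc (suc k * 3 + 2) + 2 + (suc k * 27 + 2)))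
    ≡⟨ solve (k ∷ []) ⟩
  3 * (k * k) + 37 * k + 258
    ∎
  where
  open ≡-Reasoning
  leaf : Fin (suc k) → Form (suc k + 1) 0 3 1
  leaf i = LeafF (new i) (underVs (suc k) x₀)

size-φDualMinHLT : ∀ k → size (φDualMinHLT k) ≡ 3 * (k * k) + 45 * k + 224
size-φDualMinHLT k = begin
  size (φDualMinHLT k)
    ≡⟨ size-SomeDFSTreeF (NonAncestorsF k x₀) ⟩
  218 + suc (size (∃vs k (Distinct k ∧' ⋀ k non-ancestor)))
    ≡⟨ cong (λ t → 218 + suc t) (size-block k non-ancestor 40 λ _ → refl) ⟩
  218 + suc (k + suc (k * suc (k * 3 + 2) + 2 + (k * 41 + 2)))
    ≡⟨ solve (k ∷ []) ⟩
  3 * (k * k) + 45 * k + 224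
    ∎
  where
  open ≡-Reasoning
  non-ancestor : Fin k → Form (k + 2) 0 3 1
  non-ancestor i = ¬' (AncestorF (new i) (old k zero) (underVs k (underV x₀)))

quadratic-bound : ∀ {C s k} A B D → A + B + D ≤ C → 0 < k → s ≡ A * (k * k) + B * k + D → s ≤ C * (k * k)
quadratic-bound {C} {k = k@(suc _)} A B D A+B+D≤C _ refl = begin
  A * (k * k) + B * k + D                 ≤⟨ ℕ.+-mono-≤ (ℕ.+-monoʳ-≤ (A * (k * k)) (ℕ.*-monoʳ-≤ B (ℕ.m≤m*n k k)))
                                                         (ℕ.m≤m*n D (k * k)) ⟩
  A * (k * k) + B * (k * k) + D * (k * k) ≡⟨ cong (_+ D * (k * k)) (ℕ.*-distribʳ-+ (k * k) A B) ⟨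
  (A + B) * (k * k) + D * (k * k)         ≡⟨ ℕ.*-distribʳ-+ (k * k) (A + B) D ⟨
  (A + B + D) * (k * k)                   ≤⟨ ℕ.*-monoˡ-≤ (k * k) A+B+D≤C ⟩
  C * (k * k)                             ∎
  where open ℕ.≤-Reasoning

-- Semantics of formulas and of labellings

module Semantics (G : Graph) where

  V Ed : Set
  V  = Fin (n G)
  Ed = Fin (m G)

  record Assignment (a b c d : ℕ) : Set where
    constructor assign
    field
      vertex : Fin a → V
      edge   : Fin b → Ed
      vset   : Fin c → V → Bool
      eset   : Fin d → Ed → Bool
  open Assignment public

  module _ (ρ : Assignment a b c d) where
    bindV : V → Assignment (suc a) b c d
    bindV x = assign (ext (vertex ρ) x) (edge ρ) (vset ρ) (eset ρ)

    bindE : Ed → Assignment a (suc b) c d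
    bindE e = assign (vertex ρ) (ext (edge ρ) e) (vset ρ) (eset ρ)

    bindVSet : (V → Bool) → Assignment a b (suc c) d
    bindVSet S = assign (vertex ρ) (edge ρ) (ext (vset ρ) S) (eset ρ)

    bindESet : (Ed → Bool) → Assignment a b c (suc d)
    bindESet S = assign (vertex ρ) (edge ρ) (vset ρ) (ext (eset ρ) S)

  Holds : Form a b c d → Assignment a b c d → Set
  Holds (eqV i j)  ρ = vertex ρ i ≡ vertex ρ j
  Holds (eqE i j)  ρ = edge ρ i ≡ edge ρ j
  Holds (inc i j)  ρ = T (incident G (vertex ρ i) (edge ρ j))
  Holds (memV i X) ρ = T (vset ρ X (vertex ρ i))
  Holds (memE i X) ρ = T (eset ρ X (edge ρ i))
  Holds (¬' φ)     ρ = ¬ Holds φ ρ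
  Holds (φ ∧' ψ)   ρ = Holds φ ρ × Holds ψ ρ
  Holds (φ ∨' ψ)   ρ = Holds φ ρ ⊎ Holds ψ ρ
  Holds (∃v φ)     ρ = Σ V λ x → Holds φ (bindV ρ x)
  Holds (∃e φ)     ρ = Σ Ed λ e → Holds φ (bindE ρ e)
  Holds (∃V φ)     ρ = Σ (V → Bool) λ S → Holds φ (bindVSet ρ S)
  Holds (∃E φ)     ρ = Σ (Ed → Bool) λ S → Holds φ (bindESet ρ S)
  Holds (∀v φ)     ρ = ∀ x → Holds φ (bindV ρ x)
  Holds (∀e φ)     ρ = ∀ e → Holds φ (bindE ρ e)
  Holds (∀V φ)     ρ = ∀ S → Holds φ (bindVSet ρ S)
  Holds (∀E φ)     ρ = ∀ S → Holds φ (bindESet ρ S)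

  _≋_ : {X : Set} → (Fin c → X → Bool) → (Fin c → X → Bool) → Set
  ρ ≋ ρ' = ∀ i → ρ i ≗ ρ' i

  ext-≋ : ∀ {X : Set} {ρ ρ' : Fin c → X → Bool} {S S' : X → Bool} →
          ρ ≋ ρ' → S ≗ S' → ext ρ S ≋ ext ρ' S'
  ext-≋ ρ≋ρ' S≗S' zero    = S≗S'
  ext-≋ ρ≋ρ' S≗S' (suc i) = ρ≋ρ' i

  -- subsets enumerates the values of a set variable only up to pointwise equality,
  -- so eval's set variables are related to those of ρ by ≋ rather than ≡
  eval⇔Holds : ∀ (φ : Form a b c d) (ρ : Assignment a b c d) {ρV ρE} →
               ρV ≋ vset ρ → ρE ≋ eset ρ → T (eval G φ (vertex ρ) (edge ρ) ρV ρE) ⇔ Holds φ ρ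
  eval⇔Holds (eqV i j)  ρ _ _ = T-⌊⌋⇔ (vertex ρ i ≟ vertex ρ j)
  eval⇔Holds (eqE i j)  ρ _ _ = T-⌊⌋⇔ (edge ρ i ≟ edge ρ j)
  eval⇔Holds (inc i j)  ρ _ _ = mk⇔ id id
  eval⇔Holds (memV i X) ρ ≋V _ = mk⇔ (subst T (≋V X _)) (subst T (sym (≋V X _)))
  eval⇔Holds (memE i X) ρ _ ≋E = mk⇔ (subst T (≋E X _)) (subst T (sym (≋E X _)))
  eval⇔Holds (¬' φ)     ρ ≋V ≋E = ¬-cong-⇔ (eval⇔Holds φ ρ ≋V ≋E) ⇔-∘ T-not⇔¬T
  eval⇔Holds (φ ∧' ψ)   ρ ≋V ≋E = (eval⇔Holds φ ρ ≋V ≋E ×-cong eval⇔Holds ψ ρ ≋V ≋E) ⇔-∘ T-∧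
  eval⇔Holds (φ ∨' ψ)   ρ ≋V ≋E = (eval⇔Holds φ ρ ≋V ≋E ⊎-cong eval⇔Holds ψ ρ ≋V ≋E) ⇔-∘ T-∨
  eval⇔Holds (∃v φ)     ρ ≋V ≋E = OverFin.T-any⇔∃ {k = n G}
    λ x → eval⇔Holds φ (bindV ρ x) ≋V ≋E
  eval⇔Holds (∃e φ)     ρ ≋V ≋E = OverFin.T-any⇔∃ {k = m G}
    λ x → eval⇔Holds φ (bindE ρ x) ≋V ≋E
  eval⇔Holds (∃V φ)     ρ ≋V ≋E = OverSubsets.T-any⇔∃
    λ S'≗S → eval⇔Holds φ (bindVSet ρ _) (ext-≋ ≋V S'≗S) ≋E
  eval⇔Holds (∃E φ)     ρ ≋V ≋E = OverSubsets.T-any⇔∃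
    λ S'≗S → eval⇔Holds φ (bindESet ρ _) ≋V (ext-≋ ≋E S'≗S)
  eval⇔Holds (∀v φ)     ρ ≋V ≋E = OverFin.T-all'⇔∀ {k = n G}
    λ x → eval⇔Holds φ (bindV ρ x) ≋V ≋E
  eval⇔Holds (∀e φ)     ρ ≋V ≋E = OverFin.T-all'⇔∀ {k = m G}
    λ x → eval⇔Holds φ (bindE ρ x) ≋V ≋E
  eval⇔Holds (∀V φ)     ρ ≋V ≋E = OverSubsets.T-all'⇔∀
    λ S'≗S → eval⇔Holds φ (bindVSet ρ _) (ext-≋ ≋V S'≗S) ≋E
  eval⇔Holds (∀E φ)     ρ ≋V ≋E = OverSubsets.T-all'⇔∀
    λ S'≗S → eval⇔Holds φ (bindESet ρ _) ≋V (ext-≋ ≋E S'≗S)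

  ∅ : Assignment 0 0 0 0
  ∅ = assign (λ ()) (λ ()) (λ ()) (λ ())

  ⊨⇔Holds : (φ : Sentence) → (G ⊨ φ) ⇔ Holds φ ∅
  ⊨⇔Holds φ = eval⇔Holds φ ∅ (λ ()) (λ ()) ⇔-∘ ⇔-sym T-≡

  record Labelling : Set where
    constructor labelling
    field
      r : V
      F : Ed → Bool
      L₀ L₁ L₂ : V → Bool

  labellingAt : Assignment a b c d → Vars a c d → Labelling
  labellingAt ρ x = labelling (vertex ρ (rootVar x)) (eset ρ (edgesVar x))
                              (vset ρ (layerVar₀ x)) (vset ρ (layerVar₁ x)) (vset ρ (layerVar₂ x))

  module _ (ℓ : Labelling) where
    open Labelling ℓ

    NextLayer : V → V → Set
    NextLayer v u = (T (L₀ v) × T (L₂ u)) ⊎ (T (L₁ v) × T (L₀ u)) ⊎ (T (L₂ v) × T (L₁ u))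

    Up : V → V → Set
    Up v u = v ≢ r × (Σ Ed λ e → T (F e) × T (incident G v e) × T (incident G u e)) × u ≢ v × NextLayer v u

    IsLeafL : V → Set
    IsLeafL v = ¬ Σ V λ u → Up u v

    UpClosed : (V → Bool) → Set
    UpClosed X = ∀ y u → T (X y) → Up y u → T (X u)

    AncestorL : V → V → Set
    AncestorL u v = ∀ X → T (X v) → UpClosed X → T (X u)

    record DFSLabelling : Set where
      field
        has-parent    : ∀ v → v ≡ r ⊎ Σ V (Up v)
        parent-unique : ∀ v u u' → Up v u × Up v u' → u ≡ u'
        well-founded  : ∀ (Y : V → Bool) → (∀ v → T (Y v) → Σ V λ u → Up v u × T (Y u)) → ∀ v → ¬ T (Y v)
        ancestral     : ∀ e x y → T (incident G x e) → T (incident G y e) → x ≢ y →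
                        AncestorL x y ⊎ AncestorL y x
  open DFSLabelling public

  Holds-UpClosedF : ∀ (x : Vars a c d) (ρ : Assignment a b c d) X →
                    Holds (UpClosedF X x) ρ ⇔ UpClosed (labellingAt ρ x) (vset ρ X)
  Holds-UpClosedF x ρ X = mk⇔
    (λ h y u Xy up → ¬⊎⇒→ (¬⊎⇒→ (h y u) Xy) up)
    (λ cl y u → →⇒¬⊎-by-premise (T? _) λ Xy → →⇒¬⊎-by-conclusion (T? _) (cl y u Xy))

  Holds-AncestorF : ∀ (x : Vars a c d) (ρ : Assignment a b c d) v w →
                    Holds (AncestorF v w x) ρ ⇔ AncestorL (labellingAt ρ x) (vertex ρ v) (vertex ρ w)
  Holds-AncestorF x ρ v w = mk⇔
    (λ h X Xw cl → ¬⊎⇒→ (¬⊎⇒→ (h X) Xw) (from (closedₓ X) cl))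
    (λ anc X → →⇒¬⊎-by-premise (T? _) λ Xw →
               →⇒¬⊎-by-conclusion (T? _) λ clH → anc X Xw (to (closedₓ X) clH))
    where
    closedₓ : ∀ S → Holds (UpClosedF zero (underVSet x)) (bindVSet ρ S) ⇔ UpClosed (labellingAt ρ x) S
    closedₓ S = Holds-UpClosedF (underVSet x) (bindVSet ρ S) zero

  Holds-DFSLabellingF : ∀ (x : Vars a c d) (ρ : Assignment a b c d) →
                        Holds (DFSLabellingF x) ρ ⇔ DFSLabelling (labellingAt ρ x)
  Holds-DFSLabellingF {a = a} x ρ = mk⇔
    (λ (hp , up , wf , an) → record
      { has-parent    = hp
      ; parent-unique = λ v u u' → ¬⊎⇒→ (up v u u')
      ; well-founded  = λ Y cl v Yv → wf Y ((v , Yv) , λ w → →⇒¬⊎-by-premise (T? _) (cl w))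
      ; ancestral     = λ e u w iu iw u≢w →
          Sum.map (to (ancestorₓ e u w (suc zero) zero)) (to (ancestorₓ e u w zero (suc zero)))
                  (¬⊎⇒→ (an e u w) (iu , iw , u≢w)) })
    (λ dl → has-parent dl
          , (λ v u u' → →⇒¬⊎-by-conclusion (u ≟ u') (parent-unique dl v u u'))
          , (λ Y ((v , Yv) , cl) → well-founded dl Y (λ w → ¬⊎⇒→ (cl w)) v Yv)
          , λ e u w → →⇒¬⊎-by-premise (T? _ ×-dec T? _ ×-dec ¬? (u ≟ w)) λ (iu , iw , u≢w) →
              Sum.map (from (ancestorₓ e u w (suc zero) zero)) (from (ancestorₓ e u w zero (suc zero)))
                      (ancestral dl e u w iu iw u≢w))
    where
    ancestorₓ : ∀ e u w (i j : Fin (suc (suc a))) →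
                Holds (AncestorF i j (underVs 2 x)) (bindV (bindV (bindE ρ e) u) w) ⇔
                AncestorL (labellingAt ρ x) (ext (ext (vertex ρ) u) w i) (ext (ext (vertex ρ) u) w j)
    ancestorₓ e u w = Holds-AncestorF (underVs 2 x) (bindV (bindV (bindE ρ e) u) w)

  Holds-⋀ : ∀ k (φ : Fin k → Form a b c d) ρ → Holds (⋀ k φ) ρ ⇔ (∀ i → Holds (φ i) ρ)
  Holds-⋀ zero    φ ρ = mk⇔ (λ _ ()) (λ _ _ → refl)
  Holds-⋀ (suc k) φ ρ = mk⇔ (λ (h₀ , hs) → λ { zero → h₀ ; (suc i) → to (Holds-⋀ k (φ ∘ suc) ρ) hs i })
                            (λ h → h zero , from (Holds-⋀ k (φ ∘ suc) ρ) (h ∘ suc))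

  bindVs : ∀ {k} → Assignment a b c d → (Fin k → V) → Assignment (k + a) b c d
  bindVs ρ f = assign (prepend f (vertex ρ)) (edge ρ) (vset ρ) (eset ρ)

  Holds-∃vs : ∀ k (φ : Form (k + a) b c d) ρ → Holds (∃vs k φ) ρ ⇔ Σ (Fin k → V) λ f → Holds φ (bindVs ρ f)
  Holds-∃vs zero    φ ρ = mk⇔ (λ h → (λ ()) , h) proj₂
  Holds-∃vs (suc k) φ ρ = mk⇔ (λ h → let g , x , h′ = to (Holds-∃vs k (∃v φ) ρ) h in ext g x , h′)
                              (λ (f , h) → from (Holds-∃vs k (∃v φ) ρ) (f ∘ suc , f zero , h))

  labellingAt-bindVs : ∀ {k} (x : Vars a c d) (ρ : Assignment a b c d) (f : Fin k → V) →
                       labellingAt (bindVs ρ f) (underVs k x) ≡ labellingAt ρ x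
  labellingAt-bindVs x ρ f = cong (λ r → labelling r (eset ρ (edgesVar x)) (vset ρ (layerVar₀ x))
                                                     (vset ρ (layerVar₁ x)) (vset ρ (layerVar₂ x)))
                                  (prepend-old f (vertex ρ) (rootVar x))

  Holds-Distinct : ∀ {k} (ρ : Assignment a b c d) (f : Fin k → V) →
                   Holds (Distinct k) (bindVs ρ f) ⇔ Injective _≡_ _≡_ f
  Holds-Distinct {k = k} ρ f = mk⇔ injective pairs ⇔-∘ (Π-cong-⇔ (λ i → Holds-⋀ k _ _) ⇔-∘ Holds-⋀ k _ _)
    where
    new-f : ∀ i → prepend f (vertex ρ) (new i) ≡ f i
    new-f = prepend-new f (vertex ρ)

    injective : (∀ i j → Holds (distinctPair i j (i ≟ j)) (bindVs ρ f)) → Injective _≡_ _≡_ f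
    injective h {i} {j} fi≡fj with i ≟ j | h i j
    ... | yes i≡j | _     = i≡j
    ... | no  _   | ¬same = ⊥-elim (¬same (trans (new-f i) (trans fi≡fj (sym (new-f j)))))

    pairs : Injective _≡_ _≡_ f → ∀ i j → Holds (distinctPair i j (i ≟ j)) (bindVs ρ f)
    pairs f-inj i j with i ≟ j
    ... | yes _   = λ _ → refl
    ... | no  i≢j = λ same → i≢j (f-inj (trans (sym (new-f i)) (trans same (new-f j))))

  AtLeastLeaves : ℕ → Labelling → Set
  AtLeastLeaves k ℓ = Σ (Fin k → V) λ f → Injective _≡_ _≡_ f × (∀ i → IsLeafL ℓ (f i))

  NonAncestorsEverywhere : ℕ → Labelling → Set
  NonAncestorsEverywhere k ℓ =
    ∀ v → Σ (Fin k → V) λ f → Injective _≡_ _≡_ f × (∀ i → ¬ AncestorL ℓ (f i) v)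

  Holds-AtLeastLeavesF : ∀ k (x : Vars a c d) (ρ : Assignment a b c d) →
                         Holds (AtLeastLeavesF k x) ρ ⇔ AtLeastLeaves k (labellingAt ρ x)
  Holds-AtLeastLeavesF k x ρ =
    Σ-cong-⇔ (λ f → Holds-Distinct ρ f ×-cong (Π-cong-⇔ (leaf f) ⇔-∘ Holds-⋀ k _ _)) ⇔-∘ Holds-∃vs k _ ρ
    where
    leaf : ∀ f i → Holds (LeafF (new i) (underVs k x)) (bindVs ρ f) ⇔ IsLeafL (labellingAt ρ x) (f i)
    leaf f i = ≡⇒⇔ (cong₂ IsLeafL (labellingAt-bindVs x ρ f) (prepend-new f (vertex ρ) i))

  Holds-NonAncestorsF : ∀ k (x : Vars a c d) (ρ : Assignment a b c d) →
                        Holds (NonAncestorsF k x) ρ ⇔ NonAncestorsEverywhere k (labellingAt ρ x)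
  Holds-NonAncestorsF {a = a} k x ρ = Π-cong-⇔ λ v →
    Σ-cong-⇔ (λ f → Holds-Distinct (bindV ρ v) f ×-cong (Π-cong-⇔ (non-ancestor v f) ⇔-∘ Holds-⋀ k _ _))
    ⇔-∘ Holds-∃vs k _ (bindV ρ v)
    where
    non-ancestor : ∀ v f i → Holds (¬' (AncestorF (new i) (old k zero) (underVs k (underV x)))) (bindVs (bindV ρ v) f) ⇔
                             (¬ AncestorL (labellingAt ρ x) (f i) v)
    non-ancestor v f i = ¬-cong-⇔ (≡⇒⇔ (trans (cong (λ ℓ → AncestorL ℓ (ρ′ (new i)) (ρ′ (old k zero)))
                                                    (labellingAt-bindVs (underV x) (bindV ρ v) f))
                                              (cong₂ (AncestorL (labellingAt ρ x)) (prepend-new f _ i)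
                                                     (prepend-old f (vertex (bindV ρ v)) zero)))
                                   ⇔-∘ Holds-AncestorF (underVs k (underV x)) (bindVs (bindV ρ v) f) (new i) (old k zero))
      where
      ρ′ : Fin (k + suc a) → V
      ρ′ = prepend f (vertex (bindV ρ v))

-- Trees and labellings

next : Fin 3 → Fin 3
next zero             = suc zero
next (suc zero)       = suc (suc zero)
next (suc (suc zero)) = zero

next²-≢ : ∀ c → next (next c) ≢ c
next²-≢ zero ()
next²-≢ (suc zero) ()
next²-≢ (suc (suc zero)) ()

module Trees (G : Graph) where
  open Semantics G

  Joins : Ed → V → V → Set
  Joins e v u = (proj₁ (ends G e) ≡ v × proj₂ (ends G e) ≡ u) ⊎ (proj₁ (ends G e) ≡ u × proj₂ (ends G e) ≡ v)

  incident⇔ : ∀ {v e} → T (incident G v e) ⇔ (v ≡ proj₁ (ends G e) ⊎ v ≡ proj₂ (ends G e))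
  incident⇔ {v} {e} = (T-⌊⌋⇔ (v ≟ proj₁ (ends G e)) ⊎-cong T-⌊⌋⇔ (v ≟ proj₂ (ends G e))) ⇔-∘ T-∨

  Joins? : ∀ e v u → Dec (Joins e v u)
  Joins? e v u = (proj₁ (ends G e) ≟ v ×-dec proj₂ (ends G e) ≟ u)
          ⊎-dec (proj₁ (ends G e) ≟ u ×-dec proj₂ (ends G e) ≟ v)

  joins⇒incident : ∀ {e v u} → Joins e v u → T (incident G v e) × T (incident G u e)
  joins⇒incident (inj₁ (refl , refl)) = from incident⇔ (inj₁ refl) , from incident⇔ (inj₂ refl)
  joins⇒incident (inj₂ (refl , refl)) = from incident⇔ (inj₂ refl) , from incident⇔ (inj₁ refl)

  joins⇒≢ : ∀ {e v u} → Joins e v u → u ≢ v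
  joins⇒≢ {e} (inj₁ (refl , refl)) = loopless G e ∘ sym
  joins⇒≢ {e} (inj₂ (refl , refl)) = loopless G e

  incident⇒joins : ∀ {e v u} → T (incident G v e) → T (incident G u e) → u ≢ v → Joins e v u
  incident⇒joins {e} {v} {u} iv iu u≢v with to (incident⇔ {v} {e}) iv | to (incident⇔ {u} {e}) iu
  ... | inj₁ refl | inj₁ refl = ⊥-elim (u≢v refl)
  ... | inj₁ refl | inj₂ refl = inj₁ (refl , refl)
  ... | inj₂ refl | inj₁ refl = inj₂ (refl , refl)
  ... | inj₂ refl | inj₂ refl = ⊥-elim (u≢v refl)

  joins-unique : ∀ {e v u x y} → Joins e v u → Joins e x y → (v ≡ x × u ≡ y) ⊎ (v ≡ y × u ≡ x)
  joins-unique (inj₁ (refl , refl)) (inj₁ (refl , refl)) = inj₁ (refl , refl)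
  joins-unique (inj₁ (refl , refl)) (inj₂ (refl , refl)) = inj₂ (refl , refl)
  joins-unique (inj₂ (refl , refl)) (inj₁ (refl , refl)) = inj₂ (refl , refl)
  joins-unique (inj₂ (refl , refl)) (inj₂ (refl , refl)) = inj₁ (refl , refl)

  module Depth (t : RootedSpanningTree G) where

    private
      par : V → V
      par = parent t

      minimal-depth : ∀ v → ∃ λ d → iter par d v ≡ root t × (∀ {j} → iter par j v ≡ root t → d ≤ j)
      minimal-depth v = least-witness (λ k → iter par k v ≟ root t) {proj₁ (reaches-root t v)} (proj₂ (reaches-root t v))

    depth : V → ℕ
    depth v = proj₁ (minimal-depth v)

    iter-depth : ∀ v → iter par (depth v) v ≡ root t
    iter-depth v = proj₁ (proj₂ (minimal-depth v))

    depth-minimal : ∀ {v j} → iter par j v ≡ root t → depth v ≤ j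
    depth-minimal {v} = proj₂ (proj₂ (minimal-depth v))

    depth-parent : ∀ {v} → v ≢ root t → depth v ≡ suc (depth (parent t v))
    depth-parent {v} v≢root with depth v | iter-depth v | depth-minimal {v}
    ... | zero  | v≡root | _       = ⊥-elim (v≢root v≡root)
    ... | suc d | reach  | minimal = ℕ.≤-antisym
      (minimal (trans (iter-suc par (depth (parent t v)) v) (iter-depth (parent t v))))
      (s≤s (depth-minimal (trans (sym (iter-suc par d v)) reach)))

    Ancestor? : ∀ u v → Dec (Ancestor t u v)
    Ancestor? u v = reaches? (parent t) v u

    ancestor-within-depth : ∀ {u v} → Ancestor t u v → ∃ λ j → j ≤ depth v × iter par j v ≡ u
    ancestor-within-depth {u} {v} (j , parʲv≡u) with j ℕ.≤? depth v
    ... | yes j≤d = j , j≤d , parʲv≡u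
    ... | no  j≰d = depth v , ℕ.≤-refl , (begin
      iter par (depth v) v                          ≡⟨ iter-depth v ⟩
      root t                                        ≡⟨ iter-fixed par (parent-root t) (j ∸ depth v) ⟨
      iter par (j ∸ depth v) (root t)               ≡⟨ cong (iter par (j ∸ depth v)) (iter-depth v) ⟨
      iter par (j ∸ depth v) (iter par (depth v) v) ≡⟨ iter-+ par (j ∸ depth v) (depth v) v ⟨
      iter par (j ∸ depth v + depth v) v            ≡⟨ cong (λ k → iter par k v) (ℕ.m∸n+n≡m (ℕ.<⇒≤ (ℕ.≰⇒> j≰d))) ⟩
      iter par j v                                  ≡⟨ parʲv≡u ⟩
      u                                             ∎)
      where open ≡-Reasoning

    iterates-distinct : ∀ {v i j} → i < j → j ≤ depth v → iter par i v ≢ iter par j v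
    iterates-distinct {v} {i} {j} i<j j≤d same = ℕ.<⇒≱ (shortcut-shorter i<j j≤d)
      (depth-minimal (trans (iter-shortcut par v same j≤d) (iter-depth v)))

    ancestor-count : ∀ v → Counting.count (λ u → Ancestor? u v) ≡ suc (depth v)
    ancestor-count v = ℕ.≤-antisym at-most at-least
      where
      open Counting (λ u → Ancestor? u v)

      at-least : suc (depth v) ≤ count
      at-least = injection⇒≤count (f , f-inj , λ i → toℕ i , refl)
        where
        f : Fin (suc (depth v)) → V
        f i = iter par (toℕ i) v
        f-inj : Injective _≡_ _≡_ f
        f-inj {i} {j} same with ℕ.<-cmp (toℕ i) (toℕ j)
        ... | tri< i<j _ _ = ⊥-elim (iterates-distinct i<j (ℕ.≤-pred (Fin.toℕ<n j)) same)
        ... | tri≈ _ i≡j _ = Fin.toℕ-injective i≡j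
        ... | tri> _ _ j<i = ⊥-elim (iterates-distinct j<i (ℕ.≤-pred (Fin.toℕ<n i)) (sym same))

      at-most : count ≤ suc (depth v)
      at-most with ≤count⇒injection ℕ.≤-refl
      ... | g , g-inj , g-anc = Fin.injective⇒≤ h-inj
        where
        within : ∀ i → ∃ λ j → j ≤ depth v × iter par j v ≡ g i
        within i = ancestor-within-depth (g-anc i)
        h : Fin count → Fin (suc (depth v))
        h i = fromℕ< (s≤s (proj₁ (proj₂ (within i))))
        h-inj : Injective _≡_ _≡_ h
        h-inj {i} {j} same = g-inj (begin
          g i                          ≡⟨ proj₂ (proj₂ (within i)) ⟨
          iter par (proj₁ (within i)) v ≡⟨ cong (λ k → iter par k v) (Fin.fromℕ<-injective _ _ _ _ same) ⟩
          iter par (proj₁ (within j)) v ≡⟨ proj₂ (proj₂ (within j)) ⟩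
          g j                          ∎)
          where open ≡-Reasoning

    height⇔depth : ∀ {h} → HeightAtMost t h ⇔ (∀ v → suc (depth v) ≤ h)
    height⇔depth {h} = mk⇔ to-depth (λ bounded v → depth v , bounded v , iter-depth v)
      where
      to-depth : HeightAtMost t h → ∀ v → suc (depth v) ≤ h
      to-depth bounded v with bounded v
      ... | _ , 1+K≤h , reach = ℕ.≤-trans (s≤s (depth-minimal reach)) 1+K≤h

    NonAncestors : V → ℕ → Set
    NonAncestors v k = Σ (Fin k → V) λ f → Injective _≡_ _≡_ f × (∀ i → ¬ Ancestor t (f i) v)

    depth⇔nonAncestors : ∀ {k} v → suc (depth v) ≤ n G ∸ k ⇔ NonAncestors v k
    depth⇔nonAncestors {k} v = ≤count⇔injection ⇔-∘ (cancel ⇔-∘ m≤o∸n⇔m+n≤o (s≤s z≤n))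
      where
      open Counting (∁? (λ u → Ancestor? u v))
      partition : suc (depth v) + count ≡ n G
      partition = trans (cong (_+ count) (sym (ancestor-count v))) (Counting.count+count∁≡N (λ u → Ancestor? u v))
      cancel : suc (depth v) + k ≤ n G ⇔ k ≤ count
      cancel = mk⇔ (λ le → ℕ.+-cancelˡ-≤ (suc (depth v)) k count (subst (suc (depth v) + k ≤_) (sym partition) le))
                   (λ le → subst (suc (depth v) + k ≤_) partition (ℕ.+-monoʳ-≤ (suc (depth v)) le))

    height⇔nonAncestors : ∀ {k} → HeightAtMost t (n G ∸ k) ⇔ (∀ v → NonAncestors v k)
    height⇔nonAncestors = Π-cong-⇔ depth⇔nonAncestors ⇔-∘ height⇔depth

  record Encodes (t : RootedSpanningTree G) (ℓ : Labelling) : Set where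
    field
      same-root : Labelling.r ℓ ≡ root t
      up⇒parent : ∀ {v u} → Up ℓ v u → parent t v ≡ u
      parent⇒up : ∀ {v} → v ≢ root t → Up ℓ v (parent t v)

  module _ {t : RootedSpanningTree G} {ℓ : Labelling} (enc : Encodes t ℓ) where
    open Encodes enc
    open Depth t using (Ancestor?)

    ancestor⇔ : ∀ {u v} → AncestorL ℓ u v ⇔ Ancestor t u v
    ancestor⇔ {u} {v} = mk⇔ to-ancestor from-ancestor
      where
      ancestor-of-v : V → Bool
      ancestor-of-v w = ⌊ Ancestor? w v ⌋

      closed : UpClosed ℓ ancestor-of-v
      closed y w y-anc up with toWitness y-anc
      ... | k , pᵏv≡y = fromWitness (suc k , trans (cong (parent t) pᵏv≡y) (up⇒parent up))

      to-ancestor : AncestorL ℓ u v → Ancestor t u v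
      to-ancestor anc = toWitness (anc ancestor-of-v (fromWitness (0 , refl)) closed)

      from-ancestor : Ancestor t u v → AncestorL ℓ u v
      from-ancestor (k , pᵏv≡u) X Xv X-closed = subst (T ∘ X) pᵏv≡u (along k)
        where
        along : ∀ k → T (X (iter (parent t) k v))
        along zero = Xv
        along (suc k) with iter (parent t) k v ≟ root t
        ... | yes at-root = subst (T ∘ X) (sym (trans (cong (parent t) at-root) (trans (parent-root t) (sym at-root))))
                                  (along k)
        ... | no  ¬root   = X-closed _ _ (along k) (parent⇒up ¬root)

    leaf⇔ : ∀ {v} → IsLeafL ℓ v ⇔ (isLeaf t v ≡ true)
    leaf⇔ {v} = ⇔-sym (¬-cong-⇔ (children⇔ ⇔-∘ OverFin.T-any⇔∃ {k = n G} child⇔)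
                       ⇔-∘ (T-not⇔¬T ⇔-∘ ⇔-sym T-≡))
      where
      child⇔ : ∀ u → T (not ⌊ u ≟ v ⌋ ∧ ⌊ parent t u ≟ v ⌋) ⇔ (u ≢ v × parent t u ≡ v)
      child⇔ u = (T-not⌊⌋⇔¬ (u ≟ v) ×-cong T-⌊⌋⇔ (parent t u ≟ v)) ⇔-∘ T-∧
      children⇔ : (Σ V λ u → u ≢ v × parent t u ≡ v) ⇔ (Σ V λ u → Up ℓ u v)
      children⇔ = mk⇔ (λ (u , u≢v , pu≡v) → u , subst (Up ℓ u) pu≡v (parent⇒up (u≢root u≢v pu≡v)))
                      (λ (u , up) → u , (λ u≡v → proj₁ (proj₂ (proj₂ up)) (sym u≡v)) , up⇒parent up)
        where
        u≢root : ∀ {u} → u ≢ v → parent t u ≡ v → u ≢ root t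
        u≢root u≢v pu≡v u≡root =
          u≢v (trans u≡root (sym (trans (sym pu≡v) (trans (cong (parent t) u≡root) (parent-root t)))))

    dfsLabelling : IsDFSTree t → DFSLabelling ℓ
    dfsLabelling dfs = record
      { has-parent    = has-parent′
      ; parent-unique = λ v u u' (up , up') → trans (sym (up⇒parent up)) (up⇒parent up')
      ; well-founded  = λ Y closed v → let K , reach = reaches-root t v in unreached Y closed K v reach
      ; ancestral     = ancestral′
      }
      where
      has-parent′ : ∀ v → v ≡ Labelling.r ℓ ⊎ Σ V (Up ℓ v)
      has-parent′ v with v ≟ root t
      ... | yes v≡root = inj₁ (trans v≡root (sym same-root))
      ... | no  v≢root = inj₂ (parent t v , parent⇒up v≢root)

      unreached : ∀ (Y : V → Bool) → (∀ v → T (Y v) → Σ V λ u → Up ℓ v u × T (Y u)) →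
                  ∀ K v → iter (parent t) K v ≡ root t → ¬ T (Y v)
      unreached Y closed zero    v v≡root Yv = proj₁ (proj₁ (proj₂ (closed v Yv))) (trans v≡root (sym same-root))
      unreached Y closed (suc K) v reach  Yv with closed v Yv
      ... | u , up , Yu = unreached Y closed K u
              (trans (cong (iter (parent t) K) (sym (up⇒parent up))) (trans (sym (iter-suc (parent t) K v)) reach)) Yu

      ancestral′ : ∀ e x y → T (incident G x e) → T (incident G y e) → x ≢ y →
                   AncestorL ℓ x y ⊎ AncestorL ℓ y x
      ancestral′ e x y ix iy x≢y with incident⇒joins {e} {x} {y} ix iy (x≢y ∘ sym) | dfs e
      ... | inj₁ (refl , refl) | anc = Sum.map (from ancestor⇔) (from ancestor⇔) anc
      ... | inj₂ (refl , refl) | anc = Sum.swap (Sum.map (from ancestor⇔) (from ancestor⇔) anc)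

  module TreeLabelling (t : RootedSpanningTree G) where
    open Depth t using (depth; depth-parent)

    layer : V → Fin 3
    layer v = iter next (depth v) zero

    layer-parent : ∀ {v} → v ≢ root t → layer v ≡ next (layer (parent t v))
    layer-parent v≢root = cong (λ d → iter next d zero) (depth-parent v≢root)

    IsTreeEdge : Ed → Set
    IsTreeEdge e = Σ V λ v → v ≢ root t × Joins e v (parent t v)

    IsTreeEdge? : ∀ e → Dec (IsTreeEdge e)
    IsTreeEdge? e = Fin.any? λ v → ¬? (v ≟ root t) ×-dec Joins? e v (parent t v)

    inLayer : Fin 3 → V → Bool
    inLayer c v = ⌊ layer v ≟ c ⌋

    treeLabelling : Labelling
    treeLabelling = labelling (root t) (λ e → ⌊ IsTreeEdge? e ⌋)
                              (inLayer zero) (inLayer (suc zero)) (inLayer (suc (suc zero)))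

    nextLayer⇔ : ∀ {v u} → NextLayer treeLabelling v u ⇔ (layer v ≡ next (layer u))
    nextLayer⇔ {v} {u} = mk⇔ to-next (from-next (layer u) refl)
      where
      to-next : NextLayer treeLabelling v u → layer v ≡ next (layer u)
      to-next (inj₁ (v₀ , u₂))        = trans (toWitness v₀) (sym (cong next (toWitness u₂)))
      to-next (inj₂ (inj₁ (v₁ , u₀))) = trans (toWitness v₁) (sym (cong next (toWitness u₀)))
      to-next (inj₂ (inj₂ (v₂ , u₁))) = trans (toWitness v₂) (sym (cong next (toWitness u₁)))
      from-next : ∀ c → layer u ≡ c → layer v ≡ next (layer u) → NextLayer treeLabelling v u
      from-next zero             u≡ v≡ = inj₂ (inj₁ (fromWitness (trans v≡ (cong next u≡)) , fromWitness u≡))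
      from-next (suc zero)       u≡ v≡ = inj₂ (inj₂ (fromWitness (trans v≡ (cong next u≡)) , fromWitness u≡))
      from-next (suc (suc zero)) u≡ v≡ = inj₁ (fromWitness (trans v≡ (cong next u≡)) , fromWitness u≡)

    -- layers grow by one (mod 3) from parent to child, so a tree edge traversed
    -- from parent to child cannot satisfy NextLayer
    treeLabelling-encodes : Encodes t treeLabelling
    treeLabelling-encodes = record { same-root = refl ; up⇒parent = up⇒parent ; parent⇒up = parent⇒up }
      where
      up⇒parent : ∀ {v u} → Up treeLabelling v u → parent t v ≡ u
      up⇒parent {v} {u} (_ , (e , tree-edge , iv , iu) , u≢v , next-layer) with toWitness tree-edge
      ... | w , w≢root , joins-w with joins-unique (incident⇒joins iv iu u≢v) joins-w
      ...   | inj₁ (v≡w , u≡pw) = trans (cong (parent t) v≡w) (sym u≡pw)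
      ...   | inj₂ (v≡pw , u≡w) = ⊥-elim (next²-≢ (layer v) (sym (begin
        layer v                   ≡⟨ to nextLayer⇔ next-layer ⟩
        next (layer u)            ≡⟨ cong (next ∘ layer) u≡w ⟩
        next (layer w)            ≡⟨ cong next (layer-parent w≢root) ⟩
        next (next (layer (parent t w))) ≡⟨ cong (next ∘ next ∘ layer) v≡pw ⟨
        next (next (layer v))     ∎)))
        where open ≡-Reasoning

      parent⇒up : ∀ {v} → v ≢ root t → Up treeLabelling v (parent t v)
      parent⇒up {v} v≢root with parent-edge t v v≢root
      ... | e , joins = v≢root , (e , fromWitness (v , v≢root , joins) , joins⇒incident joins) ,
                        joins⇒≢ joins , from nextLayer⇔ (layer-parent v≢root)

  module LabellingTree {ℓ : Labelling} (dl : DFSLabelling ℓ) where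
    open Labelling ℓ using (r)

    parentOf : V → V
    parentOf v with has-parent dl v
    ... | inj₁ _       = r
    ... | inj₂ (u , _) = u

    parentOf-up : ∀ {v} → v ≢ r → Up ℓ v (parentOf v)
    parentOf-up {v} v≢r with has-parent dl v
    ... | inj₁ v≡r      = ⊥-elim (v≢r v≡r)
    ... | inj₂ (_ , up) = up

    parentOf-root : parentOf r ≡ r
    parentOf-root with has-parent dl r
    ... | inj₁ _        = refl
    ... | inj₂ (_ , up) = ⊥-elim (proj₁ up refl)

    -- the vertices from which r is unreachable form a set in which every vertex has its parent
    reaches-r : ∀ v → ∃ λ k → iter parentOf k v ≡ r
    reaches-r v with reaches? parentOf v r
    ... | yes reach = reach
    ... | no ¬reach = ⊥-elim (well-founded dl unreached closed v (fromWitnessFalse ¬reach))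
      where
      unreached : V → Bool
      unreached w = not ⌊ reaches? parentOf w r ⌋
      closed : ∀ w → T (unreached w) → Σ V λ u → Up ℓ w u × T (unreached u)
      closed w w-unreached = parentOf w , parentOf-up w≢r , fromWitnessFalse λ (k , reach) →
                               toWitnessFalse w-unreached (suc k , trans (iter-suc parentOf k w) reach)
        where
        w≢r : w ≢ r
        w≢r w≡r = toWitnessFalse w-unreached (0 , w≡r)

    parentOf-edge : ∀ v → v ≢ r → Adj G v (parentOf v)
    parentOf-edge v v≢r with parentOf-up v≢r
    ... | _ , (e , _ , iv , iu) , u≢v , _ = e , incident⇒joins iv iu u≢v

    labellingTree : RootedSpanningTree G
    labellingTree = record
      { root         = r
      ; parent       = parentOf
      ; parent-root  = parentOf-root
      ; parent-edge  = parentOf-edge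
      ; reaches-root = reaches-r
      }

    labellingTree-encodes : Encodes labellingTree ℓ
    labellingTree-encodes = record
      { same-root = refl
      ; up⇒parent = λ up → parent-unique dl _ _ _ (parentOf-up (proj₁ up) , up)
      ; parent⇒up = parentOf-up
      }

    labellingTree-dfs : IsDFSTree labellingTree
    labellingTree-dfs e = Sum.map (to (ancestor⇔ labellingTree-encodes)) (to (ancestor⇔ labellingTree-encodes))
      (ancestral dl e _ _ (proj₁ incident-ends) (proj₂ incident-ends) (loopless G e))
      where
      incident-ends : T (incident G (proj₁ (ends G e)) e) × T (incident G (proj₂ (ends G e)) e)
      incident-ends = joins⇒incident (inj₁ (refl , refl))

  assignmentOf : Labelling → Assignment 1 0 3 1
  assignmentOf (labelling r F L₀ L₁ L₂) = bindVSet (bindVSet (bindVSet (bindESet (bindV ∅ r) F) L₀) L₁) L₂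

  module _ (ψ : Form 1 0 3 1) (P : RootedSpanningTree G → Set)
           (ψ⇔P : ∀ {t ℓ} → Encodes t ℓ → Holds ψ (assignmentOf ℓ) ⇔ P t) where

    ⊨SomeDFSTreeF⇔ : (G ⊨ SomeDFSTreeF ψ) ⇔ (Σ (RootedSpanningTree G) λ t → IsDFSTree t × P t)
    ⊨SomeDFSTreeF⇔ = mk⇔ to-tree from-tree ⇔-∘ ⊨⇔Holds (SomeDFSTreeF ψ)
      where
      to-tree : Holds (SomeDFSTreeF ψ) ∅ → Σ (RootedSpanningTree G) λ t → IsDFSTree t × P t
      to-tree (r , F , L₀ , L₁ , L₂ , dl , h) = labellingTree , labellingTree-dfs , to (ψ⇔P labellingTree-encodes) h
        where open LabellingTree (to (Holds-DFSLabellingF x₀ (assignmentOf (labelling r F L₀ L₁ L₂))) dl)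

      from-tree : (Σ (RootedSpanningTree G) λ t → IsDFSTree t × P t) → Holds (SomeDFSTreeF ψ) ∅
      from-tree (t , dfs , p) = _ , _ , _ , _ , _ ,
                                from (Holds-DFSLabellingF x₀ (assignmentOf treeLabelling))
                                     (dfsLabelling treeLabelling-encodes dfs) ,
                                from (ψ⇔P treeLabelling-encodes) p
        where open TreeLabelling t

  module _ {t : RootedSpanningTree G} {ℓ : Labelling} (enc : Encodes t ℓ) where

    atLeastLeaves⇔ : ∀ {k} → AtLeastLeaves k ℓ ⇔ (k ≤ numLeaves t)
    atLeastLeaves⇔ = ⇔-sym ≤count⇔injection ⇔-∘ Σ-cong-⇔ (λ f → ⇔-id _ ×-cong Π-cong-⇔ (λ i → leaf⇔ enc))
      where open Counting (λ v → isLeaf t v ≟ᵇ true)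

    notAtLeastLeaves⇔ : ∀ {k} → (¬ AtLeastLeaves (suc k) ℓ) ⇔ (numLeaves t ≤ k)
    notAtLeastLeaves⇔ = mk⇔ ℕ.≮⇒≥ ℕ.≤⇒≯ ⇔-∘ ¬-cong-⇔ atLeastLeaves⇔

    nonAncestorsEverywhere⇔ : ∀ {k} → NonAncestorsEverywhere k ℓ ⇔ HeightAtMost t (n G ∸ k)
    nonAncestorsEverywhere⇔ = ⇔-sym (Depth.height⇔nonAncestors t) ⇔-∘
      Π-cong-⇔ (λ v → Σ-cong-⇔ λ f → ⇔-id _ ×-cong Π-cong-⇔ (λ i → ¬-cong-⇔ (ancestor⇔ enc)))

  module _ (k : ℕ) where

    ⊨φDualMinHLT⇔ : (G ⊨ φDualMinHLT k) ⇔
                    (Σ (RootedSpanningTree G) λ t → IsDFSTree t × HeightAtMost t (n G ∸ k))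
    ⊨φDualMinHLT⇔ = ⊨SomeDFSTreeF⇔ (NonAncestorsF k x₀) _ λ {_} {ℓ} enc →
      nonAncestorsEverywhere⇔ enc ⇔-∘ Holds-NonAncestorsF k x₀ (assignmentOf ℓ)

    ⊨φMinLLT⇔ : (G ⊨ φMinLLT k) ⇔ (Σ (RootedSpanningTree G) λ t → IsDFSTree t × numLeaves t ≤ k)
    ⊨φMinLLT⇔ = ⊨SomeDFSTreeF⇔ (AtMostLeavesF k x₀) _ λ {_} {ℓ} enc →
      notAtLeastLeaves⇔ enc ⇔-∘ ¬-cong-⇔ (Holds-AtLeastLeavesF (suc k) x₀ (assignmentOf ℓ))

    ⊨φMaxLLT⇔ : (G ⊨ φMaxLLT k) ⇔ (Σ (RootedSpanningTree G) λ t → IsDFSTree t × k ≤ numLeaves t)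
    ⊨φMaxLLT⇔ = ⊨SomeDFSTreeF⇔ (AtLeastLeavesF k x₀) _ λ {_} {ℓ} enc →
      atLeastLeaves⇔ enc ⇔-∘ Holds-AtLeastLeavesF k x₀ (assignmentOf ℓ)

lemma27 : ∃ λ (C : ℕ) → ∀ (k : ℕ) → 0 < k →
            Σ Sentence λ φDual → Σ Sentence λ φMin → Σ Sentence λ φMax →
              (size φDual ≤ C * (k * k)) × (size φMin ≤ C * (k * k)) × (size φMax ≤ C * (k * k)) ×
              (∀ (G : Graph) → Connected G →
                ((G ⊨ φDual) ⇔ (Σ (RootedSpanningTree G) λ T → IsDFSTree T × HeightAtMost T (n G ∸ k))) ×
                ((G ⊨ φMin) ⇔ (Σ (RootedSpanningTree G) λ T → IsDFSTree T × numLeaves T ≤ k)) ×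
                ((G ⊨ φMax) ⇔ (Σ (RootedSpanningTree G) λ T → IsDFSTree T × k ≤ numLeaves T)))
lemma27 = 300 , λ k 0<k →
  φDualMinHLT k , φMinLLT k , φMaxLLT k ,
  quadratic-bound 3 45 224 (ℕ.≤ᵇ⇒≤ 272 300 _) 0<k (size-φDualMinHLT k) ,
  quadratic-bound 3 37 258 (ℕ.≤ᵇ⇒≤ 298 300 _) 0<k (size-φMinLLT k) ,
  quadratic-bound 3 31 223 (ℕ.≤ᵇ⇒≤ 257 300 _) 0<k (size-φMaxLLT k) ,
  λ G _ → let open Trees G in ⊨φDualMinHLT⇔ k , ⊨φMinLLT⇔ k , ⊨φMaxLLT⇔ k
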